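{- There exists a system $\mathcal{F}$ of equations in the variables $x,y,z$ and $9$ further variables, each equation of $\mathcal{F}$ being of the form $\alpha+1=\gamma$ or $\alpha \cdot \beta=\gamma$ with $\alpha,\beta,\gamma$ among these $12$ variables, such that for all positive integers $x,y,z$: $x+y=z$ holds if and only if there exist positive integer values of the $9$ further variables which together with $x,y,z$ satisfy $\mathcal{F}$. -}

module Defs where

open import Data.Nat using (ℕ; _+_; _*_; _<_)
open import Data.Fin using (Fin; zero; suc)
open import Data.List using (List)
open import Data.List.Relation.Unary.All using (All)
open import Relation.Binary.PropositionalEquality using (_≡_)

Var : Set
Var = Fin 12

x y z : Var
x = zero
y = suc zero
z = suc (suc zero)

data Equation : Set where
  succEq : (α γ : Var) → Equation
  mulEq  : (α β γ : Var) → Equation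

System : Set
System = List Equation

Assignment : Set
Assignment = Var → ℕ

Satisfies : Assignment → Equation → Set
Satisfies v (succEq α γ)  = v α + 1 ≡ v γ
Satisfies v (mulEq α β γ) = v α * v β ≡ v γ

SatisfiesSystem : Assignment → System → Set
SatisfiesSystem v F = All (Satisfies v) F

Positive : Assignment → Set
Positive v = (i : Var) → 0 < v i

{-# OPTIONS --safe #-}
-- For c > 0, x + y = z is equivalent to the single polynomial identity
--   (zx + 1)(zy + 1) = z²(xy + 1) + 1,
-- since expanding both sides leaves z(x + y) = z².  Splitting each side into
-- one addition of 1 or one multiplication at a time needs exactly nine
-- auxiliary variables, whose values are then forced by x, y and z.
module Submission where

open import Defs
open import Data.Nat using (ℕ; _+_; _*_; _<_; NonZero; >-nonZero)
open import Data.Nat.Properties using (+-cancelʳ-≡; *-cancelˡ-≡; *-mono-≤; m≤n+m)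
open import Data.Nat.Solver using (module +-*-Solver)
open import Data.Fin using (#_)
open import Data.Vec using (Vec; []; _∷_; lookup)
open import Data.Vec.Relation.Unary.All using ([]; _∷_)
open import Data.Vec.Relation.Unary.All.Properties using (lookup⁺)
open import Data.List using ([]; _∷_)
open import Data.List.Relation.Unary.All using ([]; _∷_)
open import Data.Product using (Σ; _×_; _,_)
open import Relation.Binary.PropositionalEquality using (_≡_; refl; sym; cong; cong₂; module ≡-Reasoning)
open import Function.Bundles using (_⇔_; mk⇔; Equivalence)
open +-*-Solver using (solve; _:+_; _:*_; con; _:=_)

module _ (a b c : ℕ) where

  private
    k : ℕ
    k = c * c * (a * b) + 1

  product-expansion : (c * a + 1) * (c * b + 1) ≡ c * (a + b) + k
  product-expansion = solve 3
    (λ a b c → (c :* a :+ con 1) :* (c :* b :+ con 1) := c :* (a :+ b) :+ (c :* c :* (a :* b) :+ con 1))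
    refl a b c

  square-expansion : c * c * (a * b + 1) + 1 ≡ c * c + k
  square-expansion = solve 3
    (λ a b c → c :* c :* (a :* b :+ con 1) :+ con 1 := c :* c :+ (c :* c :* (a :* b) :+ con 1))
    refl a b c

  sum⇔product-identity : .{{NonZero c}} →
    (a + b ≡ c) ⇔ ((c * a + 1) * (c * b + 1) ≡ c * c * (a * b + 1) + 1)
  sum⇔product-identity = mk⇔ to from
    where
    open ≡-Reasoning
    to : a + b ≡ c → (c * a + 1) * (c * b + 1) ≡ c * c * (a * b + 1) + 1
    to a+b≡c = begin
      (c * a + 1) * (c * b + 1)  ≡⟨ product-expansion ⟩
      c * (a + b) + k            ≡⟨ cong (λ s → c * s + k) a+b≡c ⟩
      c * c + k                  ≡⟨ sym square-expansion ⟩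
      c * c * (a * b + 1) + 1    ∎
    from : (c * a + 1) * (c * b + 1) ≡ c * c * (a * b + 1) + 1 → a + b ≡ c
    from identity = *-cancelˡ-≡ (a + b) c c (+-cancelʳ-≡ k (c * (a + b)) (c * c) (begin
      c * (a + b) + k            ≡⟨ sym product-expansion ⟩
      (c * a + 1) * (c * b + 1)  ≡⟨ identity ⟩
      c * c * (a * b + 1) + 1    ≡⟨ square-expansion ⟩
      c * c + k                  ∎))

u₁ u₂ u₃ u₄ u₅ u₆ u₇ u₈ u₉ : Var
u₁ = # 3
u₂ = # 4
u₃ = # 5
u₄ = # 6
u₅ = # 7
u₆ = # 8
u₇ = # 9
u₈ = # 10
u₉ = # 11

sumSystem : System
sumSystem =
  mulEq z x u₁ ∷ succEq u₁ u₂ ∷ mulEq z y u₃ ∷ succEq u₃ u₄ ∷ mulEq u₂ u₄ u₅ ∷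
  mulEq x y u₆ ∷ succEq u₆ u₇ ∷ mulEq z z u₈ ∷ mulEq u₈ u₇ u₉ ∷ succEq u₉ u₅ ∷ []

canonicalValues : ℕ → ℕ → ℕ → Vec ℕ 12
canonicalValues a b c =
  a ∷ b ∷ c ∷ c * a ∷ c * a + 1 ∷ c * b ∷ c * b + 1 ∷ (c * a + 1) * (c * b + 1) ∷
  a * b ∷ a * b + 1 ∷ c * c ∷ c * c * (a * b + 1) ∷ []

canonical : ℕ → ℕ → ℕ → Assignment
canonical a b c = lookup (canonicalValues a b c)

canonical-positive : ∀ {a b c} → 0 < a → 0 < b → 0 < c → Positive (canonical a b c)
canonical-positive {a} {b} {c} 0<a 0<b 0<c = lookup⁺ {P = 0 <_} {xs = canonicalValues a b c}
  (0<a ∷ 0<b ∷ 0<c ∷ 0<* 0<c 0<a ∷ 0<+1 (c * a) ∷ 0<* 0<c 0<b ∷ 0<+1 (c * b) ∷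
   0<* (0<+1 (c * a)) (0<+1 (c * b)) ∷ 0<* 0<a 0<b ∷ 0<+1 (a * b) ∷
   0<* 0<c 0<c ∷ 0<* (0<* 0<c 0<c) (0<+1 (a * b)) ∷ [])
  where
  0<+1 : ∀ n → 0 < n + 1
  0<+1 n = m≤n+m 1 n
  0<* : ∀ {m n} → 0 < m → 0 < n → 0 < m * n
  0<* = *-mono-≤

canonical-satisfies : ∀ a b c →
  (c * a + 1) * (c * b + 1) ≡ c * c * (a * b + 1) + 1 →
  SatisfiesSystem (canonical a b c) sumSystem
canonical-satisfies a b c identity =
  refl ∷ refl ∷ refl ∷ refl ∷ refl ∷ refl ∷ refl ∷ refl ∷ refl ∷ sym identity ∷ []

satisfies⇒product-identity : ∀ v → SatisfiesSystem v sumSystem →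
  (v z * v x + 1) * (v z * v y + 1) ≡ v z * v z * (v x * v y + 1) + 1
satisfies⇒product-identity v (e₁ ∷ e₂ ∷ e₃ ∷ e₄ ∷ e₅ ∷ e₆ ∷ e₇ ∷ e₈ ∷ e₉ ∷ e₁₀ ∷ []) = begin
  (v z * v x + 1) * (v z * v y + 1)  ≡⟨ cong₂ (λ p q → (p + 1) * (q + 1)) e₁ e₃ ⟩
  (v u₁ + 1) * (v u₃ + 1)            ≡⟨ cong₂ _*_ e₂ e₄ ⟩
  v u₂ * v u₄                        ≡⟨ e₅ ⟩
  v u₅                               ≡⟨ sym e₁₀ ⟩
  v u₉ + 1                           ≡⟨ cong (_+ 1) (sym e₉) ⟩
  v u₈ * v u₇ + 1                    ≡⟨ cong₂ (λ p q → p * q + 1) (sym e₈) (sym e₇) ⟩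
  v z * v z * (v u₆ + 1) + 1         ≡⟨ cong (λ p → v z * v z * (p + 1) + 1) (sym e₆) ⟩
  v z * v z * (v x * v y + 1) + 1    ∎
  where open ≡-Reasoning

corollary5 : Σ System λ F →
    (a b c : ℕ) → 0 < a → 0 < b → 0 < c →
      (a + b ≡ c) ⇔
      (Σ Assignment λ v → Positive v × v x ≡ a × v y ≡ b × v z ≡ c × SatisfiesSystem v F)
corollary5 = sumSystem , λ a b c 0<a 0<b 0<c →
  let criterion = sum⇔product-identity a b c {{>-nonZero 0<c}} in mk⇔
    (λ a+b≡c → canonical a b c , canonical-positive 0<a 0<b 0<c , refl , refl , refl ,
      canonical-satisfies a b c (Equivalence.to criterion a+b≡c))
    (λ { (v , _ , refl , refl , refl , sat) →
      Equivalence.from criterion (satisfies⇒product-identity v sat) })
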